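{- Let $\mathcal{M}$ be a rank $d$ matroid on ground set $V$, let $v_1,\dots,v_n$ be a linear ordering of $V$ with $\{v_1,\dots,v_d\}\in\mathcal{M}$, and let $F$ be the revlex smallest $d$-subset of $V$ not in $\mathcal{M}$. Then the simplicial complex generated by $\mathcal{M}\cup\{F\}$ is vertex decomposable.
   Context: A matroid of rank $d$ is a pure simplicial complex on $V$ whose facets (bases) all have $d$ elements and satisfy: for facets $F,G$ and $x\in F\setminus G$ there is $y\in G\setminus F$ with $(F\setminus\{x\})\cup\{y\}$ a facet. Revlex order on $d$-subsets: $\{a_1<\dots<a_d\}$ precedes $\{b_1<\dots<b_d\}$ if for the largest $j$ with $a_j\ne b_j$, $a_j<b_j$. A simplex is a complex $2^W$ (including $\emptyset,\{\emptyset\}$). $\mathrm{lk}_\Delta(v)=\{G\in\Delta: v\notin G,\ G\cup\{v\}\in\Delta\}$, $\mathrm{del}_\Delta(v)=\{G\in\Delta: v\notin G\}$. $\Delta$ is vertex decomposable if it is a simplex, or it has a vertex $v$ with $\mathrm{del}_\Delta(v)$, $\mathrm{lk}_\Delta(v)$ vertex decomposable and every facet of $\mathrm{del}_\Delta(v)$ a facet of $\Delta$. -}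

module Defs where

open import Data.Bool using (Bool; true; false; T)
open import Data.Nat using (ℕ; _<_)
open import Data.Fin using (Fin; zero; suc; toℕ)
open import Data.Fin.Subset using (Subset; _∈_; _∉_; _⊆_; ∣_∣; ⁅_⁆; _∪_; ⊥)
open import Data.List using (List; []; _∷_; map; reverse)
open import Data.Vec using (Vec; []; _∷_; tabulate)
open import Data.Product using (Σ; _×_; _,_; ∃)
open import Data.Sum using (_⊎_)
open import Data.Empty renaming (⊥ to Empty)
open import Relation.Nullary using (¬_)
open import Relation.Binary.PropositionalEquality using (_≡_; _≢_)

-- Ground set V = Fin n, with the linear order v₁ < … < vₙ given by the order of Fin n.

Complex : ℕ → Set₁
Complex n = Subset n → Set

-- A matroid of rank d on Fin n, given by its (finite, hence decidable) set of bases.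
record Matroid (n d : ℕ) : Set where
  field
    isBasis  : Subset n → Bool
    size     : ∀ F → T (isBasis F) → ∣ F ∣ ≡ d
    exchange : ∀ F G → T (isBasis F) → T (isBasis G) → ∀ x → x ∈ F → x ∉ G →
               ∃ λ y → y ∈ G × y ∉ F × T (isBasis ((F Data.Fin.Subset.- x) ∪ ⁅ y ⁆))
open Matroid public

Basis : ∀ {n d} → Matroid n d → Subset n → Set
Basis M F = T (isBasis M F)

generated : ∀ {n} → (Subset n → Set) → Complex n
generated 𝓕 G = ∃ λ F → 𝓕 F × G ⊆ F

elems : ∀ {n} → Subset n → List (Fin n)
elems []          = []
elems (true ∷ p)  = zero ∷ map suc (elems p)
elems (false ∷ p) = map suc (elems p)

LexLt : ∀ {n} → List (Fin n) → List (Fin n) → Set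
LexLt []       _        = Empty
LexLt (_ ∷ _)  []       = Empty
LexLt (x ∷ xs) (y ∷ ys) = (toℕ x < toℕ y) ⊎ (x ≡ y × LexLt xs ys)

-- Revlex: A = {a₁<…<a_d} precedes B = {b₁<…<b_d} iff for the largest j with a_j ≠ b_j,
-- a_j < b_j; i.e. lex comparison of the sorted element lists read from the top.
RevlexLt : ∀ {n} → Subset n → Subset n → Set
RevlexLt A B = LexLt (reverse (elems A)) (reverse (elems B))

initialSeg : ∀ {n} → ℕ → Subset n
initialSeg {n} d = tabulate λ (i : Fin n) → Data.Nat._<ᵇ_ (toℕ i) d

IsRevlexMinNonBasis : ∀ {n d} → Matroid n d → Subset n → Set
IsRevlexMinNonBasis {d = d} M F =
  ∣ F ∣ ≡ d × ¬ Basis M F ×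
  (∀ G → ∣ G ∣ ≡ d → ¬ Basis M G → G ≢ F → RevlexLt F G)

link : ∀ {n} → Complex n → Fin n → Complex n
link Δ v G = v ∉ G × Δ (G ∪ ⁅ v ⁆)

deletion : ∀ {n} → Complex n → Fin n → Complex n
deletion Δ v G = v ∉ G × Δ G

IsFacet : ∀ {n} → Complex n → Subset n → Set
IsFacet Δ G = Δ G × (∀ H → Δ H → G ⊆ H → H ≡ G)

-- A simplex: the void complex ∅, or 2^W for some W (W = ∅ gives {∅}).
IsSimplex : ∀ {n} → Complex n → Set
IsSimplex Δ = (∀ G → ¬ Δ G) ⊎ (∃ λ W → ∀ G → (Δ G → G ⊆ W) × (G ⊆ W → Δ G))

data VertexDecomposable {n : ℕ} : Complex n → Set₁ where
  simplex : ∀ {Δ} → IsSimplex Δ → VertexDecomposable Δ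
  decomp  : ∀ {Δ} (v : Fin n) → Δ ⁅ v ⁆ →
            VertexDecomposable (deletion Δ v) →
            VertexDecomposable (link Δ v) →
            (∀ G → IsFacet (deletion Δ v) G → IsFacet Δ G) →
            VertexDecomposable Δ

{-# OPTIONS --safe #-}
-- Matroid complexes are vertex decomposable: a vertex lying in some but not all bases is a
-- shedding vertex, and its deletion and link are again matroid complexes.
--
-- Since {v₁,…,v_d} is a basis and F is not, some c ∈ {v₁,…,v_d} misses F while some element
-- of F lies outside {v₁,…,v_d}, so c < max F.  Exchanging max F for c gives a revlex smaller
-- d-set, hence a basis B₀ ⊆ F ∪ {c} containing c.  On the ground set F ∪ {c}, c is a shedding
-- vertex whose deletion is the simplex 2^F.  The remaining vertices are then added in order;
-- a new vertex w lying in a basis is shed because B₀ avoids w, so the exchange axiom moves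
-- every face avoiding w into a basis avoiding w.
module Submission where

open import Defs
open import Data.Bool using (true; false)
open import Data.Bool.Properties using (T?; T-≡)
open import Data.Empty using (⊥-elim)
open import Data.Fin using (Fin; zero; suc; toℕ; fromℕ<)
open import Data.Fin.Properties using (_≟_; toℕ-injective; toℕ<n; toℕ-fromℕ<; any?)
open import Data.Fin.Subset
  using (Subset; _∈_; _∉_; _⊆_; _⊂_; ∣_∣; ⁅_⁆; _∪_; _─_; _-_; ⊤; Lift; inside; outside)
  renaming (⊥ to ∅)
open import Data.Fin.Subset.Induction using (⊂-wellFounded)
open import Data.Fin.Subset.Properties
  using ( _∈?_; ⊆-antisym; ⊆-max; p⊂q⇒∣p∣<∣q∣; p⊆p∪q; q⊆p∪q; x∈p∪q⁻; x∈⁅x⁆; x∈⁅y⁆⇒x≡y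
        ; p─q⊆p; x∈p∧x≢y⇒x∈p-y; x∈p⇒p-x⊂p; ∪-identityʳ; p─⊥≡p; Lift?; anySubset?
        ; nonempty?; Empty-unique; drop-there)
open import Data.List using (List; []; _∷_; map; reverse; _∷ʳ_)
open import Data.List.Properties using (unfold-reverse; reverse-map)
open import Data.List.Membership.Propositional using () renaming (_∈_ to _∈ₗ_)
open import Data.List.Membership.Propositional.Properties using (∈-map⁻)
open import Data.List.Relation.Unary.Any using (here; there)
open import Data.List.Relation.Unary.Any.Properties using (reverse⁻)
open import Data.Nat using (ℕ; zero; suc; pred; _≤_; _<_; _<?_; z≤n; s≤s)
open import Data.Nat.Properties
  using ( ≤-refl; ≤-trans; ≤-reflexive; <⇒≤; <-≤-trans; ≮⇒≥; <⇒≱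
        ; ≤∧≢⇒<; m<n⇒m<1+n; m<1+n⇒m<n∨m≡n; <ᵇ⇒<; <⇒<ᵇ)
open import Data.Product using (∃; ∃₂; _×_; _,_; proj₁; proj₂)
import Data.Product as Product
open import Data.Sum using (_⊎_; inj₁; inj₂; [_,_]′)
import Data.Sum as Sum
open import Data.Vec using (_∷_; here; there)
open import Data.Vec.Properties using (lookup∘tabulate; []=⇒lookup; lookup⇒[]=)
open import Function using (_∘_; id; Equivalence)
open import Induction.WellFounded using (Acc; acc)
open import Relation.Nullary using (¬_; Dec; yes; no; ¬?)
open import Relation.Nullary.Decidable using (⌊_⌋; _×-dec_; _⊎-dec_; toWitness; fromWitness)
open import Relation.Unary using (Pred; Decidable; _≐_)
open import Relation.Unary.Properties using (≐-sym)
open import Relation.Binary.PropositionalEquality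
  using (_≡_; _≢_; refl; sym; trans; cong; subst; module ≡-Reasoning)

private variable
  n d : ℕ
  x y v : Fin n
  p q B G : Subset n
  𝓐 𝓑 : Subset n → Set

x∈p─q⇒x∉q : ∀ (p q : Subset n) → x ∈ p ─ q → x ∉ q
x∈p─q⇒x∉q (inside ∷ p) (outside ∷ q) here ()
x∈p─q⇒x∉q (_ ∷ p)      (_ ∷ q)       (there x∈p─q) (there x∈q) = x∈p─q⇒x∉q p q x∈p─q x∈q

x∈p-y⇒x∈p : x ∈ p - y → x ∈ p
x∈p-y⇒x∈p {p = p} {y = y} = p─q⊆p p ⁅ y ⁆

x∈p-y⇒x≢y : x ∈ p - y → x ≢ y
x∈p-y⇒x≢y {p = p} {y = y} x∈p-y refl = x∈p─q⇒x∉q p ⁅ y ⁆ x∈p-y (x∈⁅x⁆ y)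

x∈p∪⁅x⁆ : x ∈ p ∪ ⁅ x ⁆
x∈p∪⁅x⁆ {x = x} {p = p} = q⊆p∪q p ⁅ x ⁆ (x∈⁅x⁆ x)

x∈p∪⁅y⁆⁻ : x ∈ p ∪ ⁅ y ⁆ → x ∈ p ⊎ x ≡ y
x∈p∪⁅y⁆⁻ {p = p} {y = y} = Sum.map₂ (x∈⁅y⁆⇒x≡y y) ∘ x∈p∪q⁻ p ⁅ y ⁆

x≡y⇒x∈p∪⁅y⁆ : x ≡ y → x ∈ p ∪ ⁅ y ⁆
x≡y⇒x∈p∪⁅y⁆ refl = x∈p∪⁅x⁆

p-x∪⁅x⁆≡p : x ∈ p → (p - x) ∪ ⁅ x ⁆ ≡ p
p-x∪⁅x⁆≡p {x = x} {p = p} x∈p = ⊆-antisym ⊆p ⊇p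
  where
  ⊆p : (p - x) ∪ ⁅ x ⁆ ⊆ p
  ⊆p z∈ = [ x∈p-y⇒x∈p , (λ { refl → x∈p }) ]′ (x∈p∪⁅y⁆⁻ z∈)
  ⊇p : p ⊆ (p - x) ∪ ⁅ x ⁆
  ⊇p {z} z∈p with z ≟ x
  ... | yes refl = x∈p∪⁅x⁆
  ... | no z≢x   = p⊆p∪q ⁅ x ⁆ (x∈p∧x≢y⇒x∈p-y z∈p z≢x)

p∪⁅v⁆-x∪⁅y⁆≡p-x∪⁅y⁆∪⁅v⁆ : x ≢ v →
  ((p ∪ ⁅ v ⁆) - x) ∪ ⁅ y ⁆ ≡ ((p - x) ∪ ⁅ y ⁆) ∪ ⁅ v ⁆
p∪⁅v⁆-x∪⁅y⁆≡p-x∪⁅y⁆∪⁅v⁆ {x = x} {v = v} {p = p} {y = y} x≢v = ⊆-antisym ⊆rhs ⊆lhs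
  where
  ⊆rhs : ((p ∪ ⁅ v ⁆) - x) ∪ ⁅ y ⁆ ⊆ ((p - x) ∪ ⁅ y ⁆) ∪ ⁅ v ⁆
  ⊆rhs z∈ with x∈p∪⁅y⁆⁻ z∈
  ... | inj₂ refl = p⊆p∪q ⁅ v ⁆ x∈p∪⁅x⁆
  ... | inj₁ z∈p∪v-x with x∈p∪⁅y⁆⁻ (x∈p-y⇒x∈p z∈p∪v-x)
  ...   | inj₁ z∈p = p⊆p∪q ⁅ v ⁆ (p⊆p∪q ⁅ y ⁆ (x∈p∧x≢y⇒x∈p-y z∈p (x∈p-y⇒x≢y z∈p∪v-x)))
  ...   | inj₂ refl = x∈p∪⁅x⁆
  ⊆lhs : ((p - x) ∪ ⁅ y ⁆) ∪ ⁅ v ⁆ ⊆ ((p ∪ ⁅ v ⁆) - x) ∪ ⁅ y ⁆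
  ⊆lhs z∈ with x∈p∪⁅y⁆⁻ z∈
  ... | inj₂ refl = p⊆p∪q ⁅ y ⁆ (x∈p∧x≢y⇒x∈p-y x∈p∪⁅x⁆ (x≢v ∘ sym))
  ... | inj₁ z∈p-x∪y with x∈p∪⁅y⁆⁻ z∈p-x∪y
  ...   | inj₂ refl = x∈p∪⁅x⁆
  ...   | inj₁ z∈p-x =
    p⊆p∪q ⁅ y ⁆ (x∈p∧x≢y⇒x∈p-y (p⊆p∪q ⁅ v ⁆ (x∈p-y⇒x∈p z∈p-x)) (x∈p-y⇒x≢y z∈p-x))

p-x∪⁅y⁆⊆p∪⁅y⁆ : (p - x) ∪ ⁅ y ⁆ ⊆ p ∪ ⁅ y ⁆
p-x∪⁅y⁆⊆p∪⁅y⁆ {y = y} = [ p⊆p∪q ⁅ y ⁆ ∘ x∈p-y⇒x∈p , x≡y⇒x∈p∪⁅y⁆ ]′ ∘ x∈p∪⁅y⁆⁻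

∣p∪⁅x⁆∣≡1+∣p∣ : ∀ (p : Subset n) → x ∉ p → ∣ p ∪ ⁅ x ⁆ ∣ ≡ suc ∣ p ∣
∣p∪⁅x⁆∣≡1+∣p∣ {x = zero}  (inside  ∷ p) x∉p = ⊥-elim (x∉p here)
∣p∪⁅x⁆∣≡1+∣p∣ {x = zero}  (outside ∷ p) x∉p = cong (suc ∘ ∣_∣) (∪-identityʳ p)
∣p∪⁅x⁆∣≡1+∣p∣ {x = suc x} (inside  ∷ p) x∉p = cong suc (∣p∪⁅x⁆∣≡1+∣p∣ p (x∉p ∘ there))
∣p∪⁅x⁆∣≡1+∣p∣ {x = suc x} (outside ∷ p) x∉p = ∣p∪⁅x⁆∣≡1+∣p∣ p (x∉p ∘ there)

1+∣p-x∣≡∣p∣ : ∀ (p : Subset n) → x ∈ p → suc ∣ p - x ∣ ≡ ∣ p ∣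
1+∣p-x∣≡∣p∣ (inside  ∷ p) here          = cong (suc ∘ ∣_∣) (p─⊥≡p p)
1+∣p-x∣≡∣p∣ (inside  ∷ p) (there x∈p) = cong suc (1+∣p-x∣≡∣p∣ p x∈p)
1+∣p-x∣≡∣p∣ (outside ∷ p) (there x∈p) = 1+∣p-x∣≡∣p∣ p x∈p

∣p-x∪⁅y⁆∣≡∣p∣ : x ∈ p → y ∉ p → ∣ (p - x) ∪ ⁅ y ⁆ ∣ ≡ ∣ p ∣
∣p-x∪⁅y⁆∣≡∣p∣ {p = p} x∈p y∉p =
  trans (∣p∪⁅x⁆∣≡1+∣p∣ _ (y∉p ∘ x∈p-y⇒x∈p)) (1+∣p-x∣≡∣p∣ p x∈p)

p⊆q∧∣q∣≤∣p∣⇒q⊆p : p ⊆ q → ∣ q ∣ ≤ ∣ p ∣ → q ⊆ p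
p⊆q∧∣q∣≤∣p∣⇒q⊆p {p = p} p⊆q ∣q∣≤∣p∣ {x} x∈q with x ∈? p
... | yes x∈p = x∈p
... | no  x∉p = ⊥-elim (<⇒≱ (p⊂q⇒∣p∣<∣q∣ (p⊆q , x , x∈q , x∉p)) ∣q∣≤∣p∣)

∣p∣≤∣q∣∧p≢q⇒∃∈q∉p : ∣ p ∣ ≤ ∣ q ∣ → p ≢ q → ∃ λ x → x ∈ q × x ∉ p
∣p∣≤∣q∣∧p≢q⇒∃∈q∉p {p = p} {q = q} ∣p∣≤∣q∣ p≢q with any? (λ x → x ∈? q ×-dec ¬? (x ∈? p))
... | yes witness = witness
... | no none = ⊥-elim (p≢q (⊆-antisym (p⊆q∧∣q∣≤∣p∣⇒q⊆p q⊆p ∣p∣≤∣q∣) q⊆p))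
  where
  q⊆p : q ⊆ p
  q⊆p {x} x∈q with x ∈? p
  ... | yes x∈p = x∈p
  ... | no  x∉p = ⊥-elim (none (x , x∈q , x∉p))

-- Generated complexes and vertex decomposability

Pure : (Subset n → Set) → ℕ → Set
Pure 𝓐 d = ∀ {B} → 𝓐 B → ∣ B ∣ ≡ d

contraction : (Subset n → Set) → Fin n → Subset n → Set
contraction 𝓐 v B = v ∉ B × 𝓐 (B ∪ ⁅ v ⁆)

generated-mono : (∀ {B} → 𝓐 B → 𝓑 B) → ∀ {G} → generated 𝓐 G → generated 𝓑 G
generated-mono 𝓐⊆𝓑 (B , B∈𝓐 , G⊆B) = B , 𝓐⊆𝓑 B∈𝓐 , G⊆B

generated-cong : 𝓐 ≐ 𝓑 → generated 𝓐 ≐ generated 𝓑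
generated-cong (𝓐⊆𝓑 , 𝓑⊆𝓐) = generated-mono 𝓐⊆𝓑 , generated-mono 𝓑⊆𝓐

link-generated : ∀ (𝓐 : Subset n → Set) v → link (generated 𝓐) v ≐ generated (contraction 𝓐 v)
link-generated 𝓐 v = to , from
  where
  to : ∀ {G} → link (generated 𝓐) v G → generated (contraction 𝓐 v) G
  to {G} (v∉G , B , B∈𝓐 , G∪v⊆B) =
    B - v , ((λ v∈B-v → x∈p-y⇒x≢y v∈B-v refl) , subst 𝓐 (sym (p-x∪⁅x⁆≡p v∈B)) B∈𝓐) , G⊆B-v
    where
    v∈B : v ∈ B
    v∈B = G∪v⊆B x∈p∪⁅x⁆
    G⊆B-v : G ⊆ B - v
    G⊆B-v x∈G = x∈p∧x≢y⇒x∈p-y (G∪v⊆B (p⊆p∪q ⁅ v ⁆ x∈G)) λ { refl → v∉G x∈G }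
  from : ∀ {G} → generated (contraction 𝓐 v) G → link (generated 𝓐) v G
  from (B , (v∉B , B∪v∈𝓐) , G⊆B) =
    v∉B ∘ G⊆B , B ∪ ⁅ v ⁆ , B∪v∈𝓐 , [ p⊆p∪q ⁅ v ⁆ ∘ G⊆B , x≡y⇒x∈p∪⁅y⁆ ]′ ∘ x∈p∪⁅y⁆⁻

isFacet-generated : Pure 𝓐 d → 𝓐 G → IsFacet (generated 𝓐) G
isFacet-generated {𝓐 = 𝓐} {G = G} pure G∈𝓐 = (G , G∈𝓐 , id) , maximal
  where
  maximal : ∀ H → generated 𝓐 H → G ⊆ H → H ≡ G
  maximal H (B , B∈𝓐 , H⊆B) G⊆H = ⊆-antisym (B⊆G ∘ H⊆B) G⊆H
    where
    B⊆G : B ⊆ G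
    B⊆G = p⊆q∧∣q∣≤∣p∣⇒q⊆p (H⊆B ∘ G⊆H) (≤-reflexive (trans (pure B∈𝓐) (sym (pure G∈𝓐))))

isFacet-cong : {Δ Γ : Complex n} → Δ ≐ Γ → IsFacet Δ G → IsFacet Γ G
isFacet-cong (Δ⊆Γ , Γ⊆Δ) (G∈Δ , maximal) = Δ⊆Γ G∈Δ , λ H H∈Γ → maximal H (Γ⊆Δ H∈Γ)

isSimplex-cong : {Δ Γ : Complex n} → Δ ≐ Γ → IsSimplex Δ → IsSimplex Γ
isSimplex-cong (Δ⊆Γ , Γ⊆Δ) (inj₁ void) = inj₁ λ G → void G ∘ Γ⊆Δ
isSimplex-cong (Δ⊆Γ , Γ⊆Δ) (inj₂ (W , Δ≡2^W)) =
  inj₂ (W , λ G → proj₁ (Δ≡2^W G) ∘ Γ⊆Δ , Δ⊆Γ ∘ proj₂ (Δ≡2^W G))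

deletion-cong : {Δ Γ : Complex n} → Δ ≐ Γ → deletion Δ v ≐ deletion Γ v
deletion-cong (Δ⊆Γ , Γ⊆Δ) = Product.map₂ Δ⊆Γ , Product.map₂ Γ⊆Δ

link-cong : {Δ Γ : Complex n} → Δ ≐ Γ → link Δ v ≐ link Γ v
link-cong (Δ⊆Γ , Γ⊆Δ) = Product.map₂ Δ⊆Γ , Product.map₂ Γ⊆Δ

vd-cong : {Δ Γ : Complex n} → Δ ≐ Γ → VertexDecomposable Δ → VertexDecomposable Γ
vd-cong Δ≐Γ (simplex Δ-simplex) = simplex (isSimplex-cong Δ≐Γ Δ-simplex)
vd-cong Δ≐Γ (decomp v v∈Δ del-vd lk-vd del-facets) =
  decomp v (proj₁ Δ≐Γ v∈Δ) (vd-cong (deletion-cong Δ≐Γ) del-vd) (vd-cong (link-cong Δ≐Γ) lk-vd)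
    λ G → isFacet-cong Δ≐Γ ∘ del-facets G ∘ isFacet-cong (deletion-cong (≐-sym Δ≐Γ))

-- Purity is what makes each facet of the deletion, a member of 𝓑 ⊆ 𝓐, a facet of ⟨𝓐⟩.
shed : ∀ v → Pure 𝓐 d → (∀ {B} → 𝓑 B → 𝓐 B) → 𝓐 B → v ∈ B →
  deletion (generated 𝓐) v ≐ generated 𝓑 →
  VertexDecomposable (generated 𝓑) → VertexDecomposable (generated (contraction 𝓐 v)) →
  VertexDecomposable (generated 𝓐)
shed {𝓐 = 𝓐} {𝓑 = 𝓑} v pure 𝓑⊆𝓐 B∈𝓐 v∈B del≐ del-vd contraction-vd =
  decomp v (_ , B∈𝓐 , λ x∈⁅v⁆ → subst (_∈ _) (sym (x∈⁅y⁆⇒x≡y v x∈⁅v⁆)) v∈B)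
    (vd-cong (≐-sym del≐) del-vd)
    (vd-cong (≐-sym (link-generated 𝓐 v)) contraction-vd)
    del-facet⇒facet
  where
  del-facet⇒facet : ∀ G → IsFacet (deletion (generated 𝓐) v) G → IsFacet (generated 𝓐) G
  del-facet⇒facet G (G∈del , maximal) with proj₁ del≐ G∈del
  ... | D , D∈𝓑 , G⊆D = isFacet-generated pure (subst 𝓐 D≡G (𝓑⊆𝓐 D∈𝓑))
    where
    D≡G : D ≡ G
    D≡G = maximal D (proj₂ del≐ (D , D∈𝓑 , id)) G⊆D

-- Matroid complexes

Exchange : (Subset n → Set) → Set
Exchange 𝓐 = ∀ B B′ → 𝓐 B → 𝓐 B′ → ∀ x → x ∈ B → x ∉ B′ →
  ∃ λ y → y ∈ B′ × y ∉ B × 𝓐 ((B - x) ∪ ⁅ y ⁆)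

matroid : (𝓐 : Subset n → Set) → Decidable 𝓐 → Pure 𝓐 d → Exchange 𝓐 → Matroid n d
matroid 𝓐 𝓐? pure exchange𝓐 = record
  { isBasis  = λ B → ⌊ 𝓐? B ⌋
  ; size     = λ B b → pure (toWitness {a? = 𝓐? B} b)
  ; exchange = λ B B′ b b′ x x∈B x∉B′ →
      let y , y∈B′ , y∉B , B-x∪y∈𝓐 =
            exchange𝓐 B B′ (toWitness {a? = 𝓐? B} b) (toWitness {a? = 𝓐? B′} b′) x x∈B x∉B′
      in y , y∈B′ , y∉B , fromWitness B-x∪y∈𝓐
  }

module _ (M : Matroid n d) where

  basis? : Decidable (Basis M)
  basis? B = T? (isBasis M B)

  basis-avoiding : ∀ {B₀} → Basis M B₀ → v ∉ B₀ → Basis M B → G ⊆ B → v ∉ G →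
    ∃ λ B′ → Basis M B′ × v ∉ B′ × G ⊆ B′
  basis-avoiding {v = v} {B = B} {G = G} {B₀} b₀ v∉B₀ b G⊆B v∉G with v ∈? B
  ... | no  v∉B = B , b , v∉B , G⊆B
  ... | yes v∈B with exchange M B B₀ b b₀ v v∈B v∉B₀
  ...   | y , y∈B₀ , _ , b′ = (B - v) ∪ ⁅ y ⁆ , b′ , v∉B′ , p⊆p∪q ⁅ y ⁆ ∘ G⊆B-v
    where
    v∉B′ : v ∉ (B - v) ∪ ⁅ y ⁆
    v∉B′ v∈B′ = [ (λ v∈B-v → x∈p-y⇒x≢y v∈B-v refl) , (λ { refl → v∉B₀ y∈B₀ }) ]′ (x∈p∪⁅y⁆⁻ v∈B′)
    G⊆B-v : G ⊆ B - v
    G⊆B-v x∈G = x∈p∧x≢y⇒x∈p-y (G⊆B x∈G) λ { refl → v∉G x∈G }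

  restrict : {A : Pred (Fin n) _} → Decidable A → Matroid n d
  restrict {A} A? = matroid (λ B → Basis M B × Lift A B) (λ B → basis? B ×-dec Lift? A? B)
                      (size M _ ∘ proj₁) exchange-restricted
    where
    exchange-restricted : Exchange (λ B → Basis M B × Lift A B)
    exchange-restricted B B′ (b , B⊆A) (b′ , B′⊆A) x x∈B x∉B′ with exchange M B B′ b b′ x x∈B x∉B′
    ... | y , y∈B′ , y∉B , b″ =
      y , y∈B′ , y∉B , b″ , [ B⊆A ∘ x∈p-y⇒x∈p , (λ { refl → B′⊆A y∈B′ }) ]′ ∘ x∈p∪⁅y⁆⁻

  restrict⁻ : {A : Pred (Fin n) _} {A? : Decidable A} → Basis (restrict A?) B → Basis M B × Lift A B
  restrict⁻ {B = B} {A? = A?} = toWitness {a? = basis? B ×-dec Lift? A? B}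

  restrict⁺ : {A : Pred (Fin n) _} {A? : Decidable A} → Basis M B → Lift A B → Basis (restrict A?) B
  restrict⁺ b B⊆A = fromWitness (b , λ {x} → B⊆A)

  restrict-mono : {A A′ : Pred (Fin n) _} {A? : Decidable A} {A′? : Decidable A′} →
    (∀ {x} → A x → A′ x) → Basis (restrict A?) B → Basis (restrict A′?) B
  restrict-mono A⊆A′ b = let b′ , B⊆A = restrict⁻ b in restrict⁺ b′ (A⊆A′ ∘ B⊆A)

  ∈-some-basis? : ∀ v → Dec (∃ λ B → Basis M B × v ∈ B)
  ∈-some-basis? v = anySubset? (λ B → basis? B ×-dec v ∈? B)

  ∉-some-basis? : ∀ v → Dec (∃ λ B → Basis M B × v ∉ B)
  ∉-some-basis? v = anySubset? (λ B → basis? B ×-dec ¬? (v ∈? B))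

  contract : Fin n → Matroid n (pred d)
  contract v = matroid (contraction (Basis M) v) (λ B → ¬? (v ∈? B) ×-dec basis? (B ∪ ⁅ v ⁆))
                 (λ { (v∉B , b) → cong pred (trans (sym (∣p∪⁅x⁆∣≡1+∣p∣ _ v∉B)) (size M _ b)) })
                 exchange-contracted
    where
    exchange-contracted : Exchange (contraction (Basis M) v)
    exchange-contracted B B′ (v∉B , b) (v∉B′ , b′) x x∈B x∉B′ =
      let y , y∈B′∪v , y∉B∪v , b″ =
            exchange M _ _ b b′ x (p⊆p∪q ⁅ v ⁆ x∈B) ([ x∉B′ , x≢v ]′ ∘ x∈p∪⁅y⁆⁻)
          y≢v : y ≢ v
          y≢v = y∉B∪v ∘ x≡y⇒x∈p∪⁅y⁆
      in y , [ id , ⊥-elim ∘ y≢v ]′ (x∈p∪⁅y⁆⁻ y∈B′∪v) , y∉B∪v ∘ p⊆p∪q ⁅ v ⁆ ,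
         [ v∉B ∘ x∈p-y⇒x∈p , y≢v ∘ sym ]′ ∘ x∈p∪⁅y⁆⁻ ,
         subst (Basis M) (p∪⁅v⁆-x∪⁅y⁆≡p-x∪⁅y⁆∪⁅v⁆ x≢v) b″
      where
      x≢v : x ≢ v
      x≢v refl = v∉B x∈B

  contraction≐contract : ∀ v → contraction (Basis M) v ≐ Basis (contract v)
  contraction≐contract v =
    fromWitness , λ {B} → toWitness {a? = ¬? (v ∈? B) ×-dec basis? (B ∪ ⁅ v ⁆)}

  deletion≐restrict : ∀ {B₀} → Basis M B₀ → v ∉ B₀ →
    deletion (generated (Basis M)) v ≐ generated (Basis (restrict (λ x → ¬? (x ≟ v))))
  deletion≐restrict {v = v} b₀ v∉B₀ = to , from
    where
    to : ∀ {G} → deletion (generated (Basis M)) v G → generated (Basis (restrict _)) G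
    to (v∉G , B , b , G⊆B) with basis-avoiding b₀ v∉B₀ b G⊆B v∉G
    ... | B′ , b′ , v∉B′ , G⊆B′ = B′ , restrict⁺ b′ (λ { x∈B′ refl → v∉B′ x∈B′ }) , G⊆B′
    from : ∀ {G} → generated (Basis (restrict _)) G → deletion (generated (Basis M)) v G
    from (B , b , G⊆B) with restrict⁻ b
    ... | b′ , B∌v = (λ v∈G → B∌v (G⊆B v∈G) refl) , B , b′ , G⊆B

matroid-vd-within : ∀ (S : Subset n) → Acc _⊂_ S → (M : Matroid n d) →
  (∀ {B} → Basis M B → B ⊆ S) → VertexDecomposable (generated (Basis M))
matroid-vd-within S (acc smaller) M bases⊆S
  with any? (λ v → ∈-some-basis? M v ×-dec ∉-some-basis? M v)
... | yes (v , (B , b , v∈B) , (B₀ , b₀ , v∉B₀)) =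
  shed {𝓑 = Basis M∖v} v (λ {B} → size M B) (proj₁ ∘ restrict⁻ M) b v∈B
    (deletion≐restrict M b₀ v∉B₀)
    (matroid-vd-within (S - v) (smaller S-v⊂S) M∖v restricted⊆S-v)
    (vd-cong (generated-cong (≐-sym (contraction≐contract M v)))
      (matroid-vd-within (S - v) (smaller S-v⊂S) (contract M v) contracted⊆S-v))
  where
  M∖v : Matroid _ _
  M∖v = restrict M (λ x → ¬? (x ≟ v))
  S-v⊂S : S - v ⊂ S
  S-v⊂S = x∈p⇒p-x⊂p (bases⊆S b v∈B)
  restricted⊆S-v : ∀ {B} → Basis M∖v B → B ⊆ S - v
  restricted⊆S-v b′ x∈B with restrict⁻ M b′
  ... | b″ , B∌v = x∈p∧x≢y⇒x∈p-y (bases⊆S b″ x∈B) (B∌v x∈B)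
  contracted⊆S-v : ∀ {B} → Basis (contract M v) B → B ⊆ S - v
  contracted⊆S-v b′ x∈B with proj₂ (contraction≐contract M v) b′
  ... | v∉B , b″ = x∈p∧x≢y⇒x∈p-y (bases⊆S b″ (p⊆p∪q ⁅ v ⁆ x∈B)) λ { refl → v∉B x∈B }
... | no no-shedding-vertex with anySubset? (basis? M)
...   | no no-basis = simplex (inj₁ λ { G (B , b , _) → no-basis (B , b) })
...   | yes (B₀ , b₀) =
  simplex (inj₂ (B₀ , λ G → (λ { (B , b , G⊆B) → B⊆B₀ b ∘ G⊆B }) , λ G⊆B₀ → B₀ , b₀ , G⊆B₀))
  where
  B⊆B₀ : ∀ {B} → Basis M B → B ⊆ B₀
  B⊆B₀ {B} b {x} x∈B with x ∈? B₀
  ... | yes x∈B₀ = x∈B₀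
  ... | no  x∉B₀ = ⊥-elim (no-shedding-vertex (x , (B , b , x∈B) , (B₀ , b₀ , x∉B₀)))

matroid-vd : (M : Matroid n d) → VertexDecomposable (generated (Basis M))
matroid-vd M = matroid-vd-within ⊤ (⊂-wellFounded ⊤) M (λ _ → ⊆-max _)

contraction-vd : (M : Matroid n d) (v : Fin n) →
  VertexDecomposable (generated (contraction (Basis M) v))
contraction-vd M v =
  vd-cong (generated-cong (≐-sym (contraction≐contract M v))) (matroid-vd (contract M v))

-- Adding one facet to a matroid complex

module ExtraFacet {n d : ℕ} (M : Matroid n d) {F : Subset n} (∣F∣≡d : ∣ F ∣ ≡ d)
  {c : Fin n} (c∉F : c ∉ F) {B₀ : Subset n} (b₀ : Basis M B₀) (c∈B₀ : c ∈ B₀)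
  (B₀⊆F∪c : B₀ ⊆ F ∪ ⁅ c ⁆) where

  Allowed : ℕ → Fin n → Set
  Allowed k x = x ∈ F ⊎ x ≡ c ⊎ toℕ x < k

  allowed? : ∀ k → Decidable (Allowed k)
  allowed? k x = x ∈? F ⊎-dec x ≟ c ⊎-dec toℕ x <? k

  Mₖ : ℕ → Matroid n d
  Mₖ k = restrict M (allowed? k)

  facets : ℕ → Subset n → Set
  facets k B = Basis (Mₖ k) B ⊎ B ≡ F

  Δ : ℕ → Complex n
  Δ k = generated (facets k)

  facets-pure : ∀ {k} → Pure (facets k) d
  facets-pure (inj₁ b)    = size M _ (proj₁ (restrict⁻ M b))
  facets-pure (inj₂ refl) = ∣F∣≡d

  B₀∈Mₖ : ∀ k → Basis (Mₖ k) B₀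
  B₀∈Mₖ k = restrict⁺ M b₀ ([ inj₁ , inj₂ ∘ inj₁ ]′ ∘ x∈p∪⁅y⁆⁻ ∘ B₀⊆F∪c)

  allowed-suc⁺ : ∀ {k} → Allowed k x → Allowed (suc k) x
  allowed-suc⁺ = Sum.map₂ (Sum.map₂ m<n⇒m<1+n)

  facets-suc⁺ : ∀ {k} → facets k B → facets (suc k) B
  facets-suc⁺ (inj₁ b)    = inj₁ (restrict-mono M allowed-suc⁺ b)
  facets-suc⁺ (inj₂ B≡F) = inj₂ B≡F

  contraction-facets-vd : ∀ k → v ∉ F → VertexDecomposable (generated (contraction (facets k) v))
  contraction-facets-vd k v∉F =
    vd-cong (generated-cong (Product.map₂ inj₁ , from)) (contraction-vd (Mₖ k) _)
    where
    from : ∀ {B} → contraction (facets k) _ B → contraction (Basis (Mₖ k)) _ B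
    from (v∉B , inj₁ b)    = v∉B , b
    from (v∉B , inj₂ B∪v≡F) = ⊥-elim (v∉F (subst (_ ∈_) B∪v≡F x∈p∪⁅x⁆))

  Δ₀-vd : VertexDecomposable (Δ 0)
  Δ₀-vd = shed {𝓑 = _≡ F} c facets-pure inj₂ (inj₁ (B₀∈Mₖ 0)) c∈B₀ (to , from)
            (simplex (inj₂ (F , λ G → (λ { (_ , refl , G⊆F) → G⊆F }) , λ G⊆F → F , refl , G⊆F)))
            (contraction-facets-vd 0 c∉F)
    where
    to : ∀ {G} → deletion (Δ 0) c G → generated (_≡ F) G
    to (c∉G , _ , inj₂ refl , G⊆F) = F , refl , G⊆F
    to (c∉G , _ , inj₁ b , G⊆B)    = F , refl , λ x∈G →
      [ id , [ (λ { refl → ⊥-elim (c∉G x∈G) }) , (λ ()) ]′ ]′ (proj₂ (restrict⁻ M b) (G⊆B x∈G))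
    from : ∀ {G} → generated (_≡ F) G → deletion (Δ 0) c G
    from (_ , refl , G⊆F) = c∉F ∘ G⊆F , F , inj₂ refl , G⊆F

  module _ {k} (k<n : k < n) where

    private
      w : Fin n
      w = fromℕ< k<n

    allowed-suc⁻ : Allowed (suc k) x → Allowed k x ⊎ x ≡ w
    allowed-suc⁻ (inj₁ x∈F)          = inj₁ (inj₁ x∈F)
    allowed-suc⁻ (inj₂ (inj₁ x≡c))   = inj₁ (inj₂ (inj₁ x≡c))
    allowed-suc⁻ (inj₂ (inj₂ x<1+k)) =
      Sum.map (inj₂ ∘ inj₂) (λ x≡k → toℕ-injective (trans x≡k (sym (toℕ-fromℕ< k<n))))
        (m<1+n⇒m<n∨m≡n x<1+k)

    basis-suc⁻ : Basis (Mₖ (suc k)) B → (w ∈ B → Allowed k w) → Basis (Mₖ k) B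
    basis-suc⁻ b w∈B⇒allowed with restrict⁻ M b
    ... | b′ , B⊆allowed = restrict⁺ M b′ λ x∈B →
      [ id , (λ { refl → w∈B⇒allowed x∈B }) ]′ (allowed-suc⁻ (B⊆allowed x∈B))

    Δ-suc≐Δ : (∀ {B} → Basis (Mₖ (suc k)) B → w ∈ B → Allowed k w) → Δ (suc k) ≐ Δ k
    Δ-suc≐Δ w-allowed = generated-cong
      ([ (λ b → inj₁ (basis-suc⁻ b (w-allowed b))) , inj₂ ]′ , facets-suc⁺)

    module _ (w-new : ¬ Allowed k w) where

      facets-avoid : facets k B → w ∉ B
      facets-avoid (inj₁ b)    w∈B = w-new (proj₂ (restrict⁻ M b) w∈B)
      facets-avoid (inj₂ refl) w∈F = w-new (inj₁ w∈F)

      deletion-suc≐Δ : deletion (Δ (suc k)) w ≐ Δ k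
      deletion-suc≐Δ = to , from
        where
        to : ∀ {G} → deletion (Δ (suc k)) w G → Δ k G
        to (w∉G , _ , inj₂ refl , G⊆F) = F , inj₂ refl , G⊆F
        to (w∉G , _ , inj₁ b , G⊆B)
          with basis-avoiding (Mₖ (suc k)) (B₀∈Mₖ (suc k)) (facets-avoid (inj₁ (B₀∈Mₖ k))) b G⊆B w∉G
        ... | B′ , b′ , w∉B′ , G⊆B′ = B′ , inj₁ (basis-suc⁻ b′ (⊥-elim ∘ w∉B′)) , G⊆B′
        from : ∀ {G} → Δ k G → deletion (Δ (suc k)) w G
        from (D , D∈facets , G⊆D) = facets-avoid D∈facets ∘ G⊆D , D , facets-suc⁺ D∈facets , G⊆D

    Δ-suc-vd : VertexDecomposable (Δ k) → VertexDecomposable (Δ (suc k))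
    Δ-suc-vd Δₖ-vd with allowed? k w | ∈-some-basis? (Mₖ (suc k)) w
    ... | yes w-allowed | _         = vd-cong (≐-sym (Δ-suc≐Δ λ _ _ → w-allowed)) Δₖ-vd
    ... | no  _ | no w-in-no-basis =
      vd-cong (≐-sym (Δ-suc≐Δ λ b w∈B → ⊥-elim (w-in-no-basis (_ , b , w∈B)))) Δₖ-vd
    ... | no  w-new | yes (B , b , w∈B) =
      shed {𝓑 = facets k} w facets-pure facets-suc⁺ (inj₁ b) w∈B (deletion-suc≐Δ w-new)
        Δₖ-vd (contraction-facets-vd (suc k) (w-new ∘ inj₁))

  Δ-vd : ∀ k → k ≤ n → VertexDecomposable (Δ k)
  Δ-vd zero    _   = Δ₀-vd
  Δ-vd (suc k) k<n = Δ-suc-vd k<n (Δ-vd k (<⇒≤ k<n))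

  vertexDecomposable : VertexDecomposable (generated (λ G → Basis M G ⊎ G ≡ F))
  vertexDecomposable =
    vd-cong (generated-cong (Sum.map₁ (proj₁ ∘ restrict⁻ M) , Sum.map₁ every-basis-allowed))
      (Δ-vd n ≤-refl)
    where
    every-basis-allowed : ∀ {B} → Basis M B → Basis (Mₖ n) B
    every-basis-allowed b = restrict⁺ M b λ {x} _ → inj₂ (inj₂ (toℕ<n x))

-- Revlex order and the initial segment

∈-elems⁻ : ∀ (X : Subset n) → x ∈ₗ elems X → x ∈ X
∈-elems⁻ (true ∷ p) (here refl) = here
∈-elems⁻ (true ∷ p) (there x∈) with ∈-map⁻ suc x∈
... | _ , y∈ , refl = there (∈-elems⁻ p y∈)
∈-elems⁻ (false ∷ p) x∈ with ∈-map⁻ suc x∈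
... | _ , y∈ , refl = there (∈-elems⁻ p y∈)

elems-∅ : ∀ n → elems (∅ {n}) ≡ []
elems-∅ zero    = refl
elems-∅ (suc n) = cong (map suc) (elems-∅ n)

reverse-elems-∷ : ∀ b (p : Subset n) {f rest} → reverse (elems p) ≡ f ∷ rest →
  ∃ λ rest′ → reverse (elems (b ∷ p)) ≡ suc f ∷ rest′
reverse-elems-∷ true p {f} {rest} eq = map suc rest ∷ʳ zero , (begin
  reverse (zero ∷ map suc (elems p))   ≡⟨ unfold-reverse zero (map suc (elems p)) ⟩
  reverse (map suc (elems p)) ∷ʳ zero  ≡⟨ cong (_∷ʳ zero) (reverse-map suc (elems p)) ⟨
  map suc (reverse (elems p)) ∷ʳ zero  ≡⟨ cong (λ L → map suc L ∷ʳ zero) eq ⟩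
  suc f ∷ (map suc rest ∷ʳ zero)       ∎)
  where open ≡-Reasoning
reverse-elems-∷ false p {rest = rest} eq =
  map suc rest , trans (sym (reverse-map suc (elems p))) (cong (map suc) eq)

reverse-elems-max : ∀ (X : Subset n) → x ∈ X →
  ∃₂ λ f rest → reverse (elems X) ≡ f ∷ rest × (∀ {y} → y ∈ X → toℕ y ≤ toℕ f)
reverse-elems-max (b ∷ p) _ with nonempty? p
... | yes (_ , y∈p) with reverse-elems-max p y∈p
...   | f , _ , eq , f-max with reverse-elems-∷ b p eq
...     | rest′ , eq′ =
  suc f , rest′ , eq′ , λ { {zero} _ → z≤n ; {suc y} y∈ → s≤s (f-max (drop-there y∈)) }
reverse-elems-max (true ∷ p) _ | no p-empty =
  zero , [] ,
  cong (λ L → reverse (zero ∷ map suc L)) (trans (cong elems (Empty-unique p-empty)) (elems-∅ _)) ,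
  λ { {zero} _ → z≤n ; {suc y} y∈ → ⊥-elim (p-empty (y , drop-there y∈)) }
reverse-elems-max (false ∷ p) (there x∈p) | no p-empty = ⊥-elim (p-empty (_ , x∈p))

max-element : ∀ (X : Subset n) → x ∈ X → ∃ λ f → f ∈ X × (∀ {y} → y ∈ X → toℕ y ≤ toℕ f)
max-element X x∈X with reverse-elems-max X x∈X
... | f , _ , eq , f-max = f , ∈-elems⁻ X (reverse⁻ (subst (f ∈ₗ_) (sym eq) (here refl))) , f-max

lexLt-head : ∀ {f} {xs ys : List (Fin n)} → LexLt (f ∷ xs) ys → ∃ λ g → g ∈ₗ ys × toℕ f ≤ toℕ g
lexLt-head {ys = g ∷ _} (inj₁ f<g)        = g , here refl , <⇒≤ f<g
lexLt-head {ys = g ∷ _} (inj₂ (refl , _)) = g , here refl , ≤-refl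

revlexLt⇒≤max : ∀ (A B : Subset n) → RevlexLt A B → x ∈ A → ∃ λ y → y ∈ B × toℕ x ≤ toℕ y
revlexLt⇒≤max A B A<B x∈A with reverse-elems-max A x∈A
... | f , _ , eq , f-max with lexLt-head (subst (λ L → LexLt L (reverse (elems B))) eq A<B)
...   | y , y∈ , f≤y = y , ∈-elems⁻ B (reverse⁻ y∈) , ≤-trans (f-max x∈A) f≤y

-- Replacing the largest element of F by a smaller one gives a revlex smaller d-set.
revlexMin-replaceMax : ∀ (M : Matroid n d) {F f c} → IsRevlexMinNonBasis M F →
  f ∈ F → (∀ {y} → y ∈ F → toℕ y ≤ toℕ f) → c ∉ F → toℕ c < toℕ f →
  Basis M ((F - f) ∪ ⁅ c ⁆)
revlexMin-replaceMax M {F} {f} {c} (∣F∣≡d , _ , F-min) f∈F f-max c∉F c<f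
  with basis? M ((F - f) ∪ ⁅ c ⁆)
... | yes b = b
... | no nb = ⊥-elim (¬F<F-f∪c (F-min _ (trans (∣p-x∪⁅y⁆∣≡∣p∣ f∈F c∉F) ∣F∣≡d) nb F-f∪c≢F))
  where
  F-f∪c≢F : (F - f) ∪ ⁅ c ⁆ ≢ F
  F-f∪c≢F eq = c∉F (subst (c ∈_) eq x∈p∪⁅x⁆)
  ¬F<F-f∪c : ¬ RevlexLt F ((F - f) ∪ ⁅ c ⁆)
  ¬F<F-f∪c F<F-f∪c with revlexLt⇒≤max F ((F - f) ∪ ⁅ c ⁆) F<F-f∪c f∈F
  ... | y , y∈F-f∪c , f≤y =
    [ y∉F-f , (λ { refl → <⇒≱ c<f f≤y }) ]′ (x∈p∪⁅y⁆⁻ {p = F - f} y∈F-f∪c)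
    where
    y∉F-f : y ∉ F - f
    y∉F-f y∈F-f = <⇒≱ (≤∧≢⇒< (f-max (x∈p-y⇒x∈p y∈F-f)) (x∈p-y⇒x≢y y∈F-f ∘ toℕ-injective)) f≤y

∈-initialSeg⁻ : x ∈ initialSeg {n} d → toℕ x < d
∈-initialSeg⁻ {x = x} {d = d} x∈ =
  <ᵇ⇒< (toℕ x) d (Equivalence.from T-≡ (trans (sym (lookup∘tabulate _ x)) ([]=⇒lookup x∈)))

∈-initialSeg⁺ : toℕ x < d → x ∈ initialSeg {n} d
∈-initialSeg⁺ {x = x} x<d =
  lookup⇒[]= x _ (trans (lookup∘tabulate _ x) (Equivalence.to T-≡ (<⇒<ᵇ x<d)))

initialSeg-gap : ∀ {F : Subset n} d → F ≢ initialSeg d → ∣ initialSeg {n} d ∣ ≡ ∣ F ∣ →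
  ∃₂ λ c x → c ∉ F × x ∈ F × toℕ c < toℕ x
initialSeg-gap d F≢I ∣I∣≡∣F∣
  with ∣p∣≤∣q∣∧p≢q⇒∃∈q∉p (≤-reflexive (sym ∣I∣≡∣F∣)) F≢I
     | ∣p∣≤∣q∣∧p≢q⇒∃∈q∉p (≤-reflexive ∣I∣≡∣F∣) (F≢I ∘ sym)
... | c , c∈I , c∉F | x , x∈F , x∉I =
  c , x , c∉F , x∈F , <-≤-trans (∈-initialSeg⁻ {d = d} c∈I) (≮⇒≥ (x∉I ∘ ∈-initialSeg⁺))

corollary3p7 : ∀ (n d : ℕ) (M : Matroid n d) → Basis M (initialSeg d) →
    (F : Subset n) → IsRevlexMinNonBasis M F →
    VertexDecomposable (generated (λ G → Basis M G ⊎ G ≡ F))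
corollary3p7 n d M I-basis F F-min@(∣F∣≡d , F-nonbasis , _)
  with initialSeg-gap d (λ F≡I → F-nonbasis (subst (Basis M) (sym F≡I) I-basis))
                      (trans (size M _ I-basis) (sym ∣F∣≡d))
... | c , x , c∉F , x∈F , c<x with max-element F x∈F
...   | f , f∈F , f-max =
  ExtraFacet.vertexDecomposable M ∣F∣≡d c∉F
    (revlexMin-replaceMax M F-min f∈F f-max c∉F (<-≤-trans c<x (f-max x∈F)))
    x∈p∪⁅x⁆ p-x∪⁅y⁆⊆p∪⁅y⁆
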